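{- Let $m\ge 2$ and let $\langle\mathfrak{u},\mathfrak{w}\rangle$ be a graphical splitted bipartite degree sequence on $m+m$ vertices, i.e. with $m$ primary and $m$ secondary vertices. Let $\mathbf{d}$ be the split graph degree sequence generated from it, obtained by adding all possible edges within the primary class; that is, every primary degree is increased by $m-1$ and the secondary degrees are unchanged. Let $d_{\max}$ and $M$ be the maximum degree and the sum of the degrees in $\mathbf{d}$. Then $\mathbf{d}$ does not satisfy the condition $d_{\max}\le\frac14\sqrt{M}$.
   Context: A splitted bipartite degree sequence is the degree sequence of a bipartite graph with designated primary and secondary vertex classes, with the degrees of the two classes listed separately. It is graphical if it has such a bipartite realization. -}

module Defs where

open import Data.Nat using (ℕ; zero; suc; _+_; _*_; _∸_; _⊔_; _≤_)
open import Data.Fin using (Fin; zero; suc; splitAt)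
open import Data.Bool using (Bool; true; false; if_then_else_)
open import Data.Sum using ([_,_]′)
open import Data.Product using (Σ; _×_; _,_)
open import Relation.Binary.PropositionalEquality using (_≡_)

sumFin : (n : ℕ) → (Fin n → ℕ) → ℕ
sumFin zero    f = 0
sumFin (suc n) f = f zero + sumFin n (λ i → f (suc i))

maxFin : (n : ℕ) → (Fin n → ℕ) → ℕ
maxFin zero    f = 0
maxFin (suc n) f = f zero ⊔ maxFin n (λ i → f (suc i))

-- A (simple) bipartite graph with p primary and q secondary vertices:
-- E i j = true iff primary vertex i is adjacent to secondary vertex j.
BipGraph : ℕ → ℕ → Set
BipGraph p q = Fin p → Fin q → Bool

indicator : Bool → ℕ
indicator b = if b then 1 else 0

primaryDeg : ∀ {p q} → BipGraph p q → Fin p → ℕ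
primaryDeg {p} {q} E i = sumFin q (λ j → indicator (E i j))

secondaryDeg : ∀ {p q} → BipGraph p q → Fin q → ℕ
secondaryDeg {p} {q} E j = sumFin p (λ i → indicator (E i j))

GraphicalBip : ∀ {p q} → (Fin p → ℕ) → (Fin q → ℕ) → Set
GraphicalBip {p} {q} u w =
  Σ (BipGraph p q) λ E →
    ((i : Fin p) → primaryDeg E i ≡ u i) × ((j : Fin q) → secondaryDeg E j ≡ w j)

-- The split-graph degree sequence generated from ⟨u, w⟩ (m primary vertices
-- made into a clique): vertices 0..m-1 primary with degree u i + (m - 1),
-- vertices m..m+n-1 secondary with degree w j.
splitSeq : ∀ m {n} → (Fin m → ℕ) → (Fin n → ℕ) → Fin (m + n) → ℕ
splitSeq m u w k = [ (λ i → u i + (m ∸ 1)) , w ]′ (splitAt m k)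

-- Hence 16 d_max² ≤ M would give 16 d_max ≤ 2m, i.e. 16 (m − 1) ≤ 2m,
-- which fails as soon as m ≥ 2.
module Submission where

open import Defs
open import Data.Nat using (ℕ; zero; suc; _+_; _*_; _∸_; _≤_; _<_; s≤s; z≤n; NonZero; >-nonZero)
open import Data.Nat.Properties
open import Data.Nat.Tactic.RingSolver using (solve-∀)
open import Data.Fin using (Fin; zero; suc; _↑ˡ_)
open import Data.Fin.Properties using (splitAt-↑ˡ)
open import Data.Sum using ([_,_]′)
open import Relation.Nullary using (¬_)
open import Relation.Binary.PropositionalEquality using (_≡_; cong)

sumFin-≤-* : ∀ n (f : Fin n → ℕ) {d} → (∀ i → f i ≤ d) → sumFin n f ≤ n * d
sumFin-≤-* zero    f f≤d = z≤n
sumFin-≤-* (suc n) f f≤d =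
  +-mono-≤ (f≤d zero) (sumFin-≤-* n (λ i → f (suc i)) (λ i → f≤d (suc i)))

f≤maxFin : ∀ n (f : Fin n → ℕ) i → f i ≤ maxFin n f
f≤maxFin (suc n) f zero    = m≤m⊔n _ _
f≤maxFin (suc n) f (suc i) = ≤-trans (f≤maxFin n (λ j → f (suc j)) i) (m≤n⊔m _ _)

sumFin≤n*maxFin : ∀ n (f : Fin n → ℕ) → sumFin n f ≤ n * maxFin n f
sumFin≤n*maxFin n f = sumFin-≤-* n f (f≤maxFin n f)

splitSeq-↑ˡ : ∀ m {n} (u : Fin m → ℕ) (w : Fin n → ℕ) i →
  splitSeq m u w (i ↑ˡ n) ≡ u i + (m ∸ 1)
splitSeq-↑ˡ m {n} u w i = cong [ (λ j → u j + (m ∸ 1)) , w ]′ (splitAt-↑ˡ m i n)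

m∸1≤maxFin-splitSeq : ∀ m {n} (u : Fin m → ℕ) (w : Fin n → ℕ) → Fin m →
  m ∸ 1 ≤ maxFin (m + n) (splitSeq m u w)
m∸1≤maxFin-splitSeq m {n} u w i = begin
  m ∸ 1                     ≤⟨ m≤n+m (m ∸ 1) (u i) ⟩
  u i + (m ∸ 1)             ≡⟨ splitSeq-↑ˡ m u w i ⟨
  splitSeq m u w (i ↑ˡ n)   ≤⟨ f≤maxFin (m + n) (splitSeq m u w) (i ↑ˡ n) ⟩
  maxFin (m + n) (splitSeq m u w) ∎
  where open ≤-Reasoning

*-cancelʳ-16*d²≤ : ∀ d n .{{_ : NonZero d}} → 16 * (d * d) ≤ n * d → 16 * d ≤ n
*-cancelʳ-16*d²≤ d n 16d²≤nd =
  *-cancelʳ-≤ (16 * d) n d (≤-trans (≤-reflexive (*-assoc 16 d d)) 16d²≤nd)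

m+m<16*[m∸1] : ∀ m → 2 ≤ m → m + m < 16 * (m ∸ 1)
m+m<16*[m∸1] (suc (suc k)) (s≤s (s≤s z≤n)) = begin-strict
  suc (suc k) + suc (suc k)  ≡⟨ 2+k+[2+k]≡4+2*k k ⟩
  4 + 2 * k                  <⟨ +-mono-<-≤ {4} {16} {2 * k} 4<16 (*-monoˡ-≤ k 2≤16) ⟩
  16 + 16 * k                ≡⟨ *-suc 16 k ⟨
  16 * suc k                 ∎
  where
  open ≤-Reasoning
  4<16 : 4 < 16
  4<16 = s≤s (s≤s (s≤s (s≤s (s≤s z≤n))))
  2≤16 : 2 ≤ 16
  2≤16 = s≤s (s≤s z≤n)
  2+k+[2+k]≡4+2*k : ∀ k → suc (suc k) + suc (suc k) ≡ 4 + 2 * k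
  2+k+[2+k]≡4+2*k = solve-∀

theorem5p4 : (m : ℕ) → 2 ≤ m → (u w : Fin m → ℕ) → GraphicalBip u w →
    ¬ (16 * (maxFin (m + m) (splitSeq m u w) * maxFin (m + m) (splitSeq m u w))
         ≤ sumFin (m + m) (splitSeq m u w))
theorem5p4 m@(suc (suc _)) 2≤m@(s≤s (s≤s z≤n)) u w _ 16d²≤M =
  <⇒≱ (m+m<16*[m∸1] m 2≤m) (≤-trans (*-monoʳ-≤ 16 m∸1≤d) 16d≤m+m)
  where
  d : ℕ
  d = maxFin (m + m) (splitSeq m u w)
  m∸1≤d : m ∸ 1 ≤ d
  m∸1≤d = m∸1≤maxFin-splitSeq m u w zero
  instance
    d≢0 : NonZero d
    d≢0 = >-nonZero (≤-trans (s≤s z≤n) m∸1≤d)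
  16d≤m+m : 16 * d ≤ m + m
  16d≤m+m = *-cancelʳ-16*d²≤ d (m + m)
    (≤-trans 16d²≤M (sumFin≤n*maxFin (m + m) (splitSeq m u w)))
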